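{- Let $n\geq 3$ be an odd integer. If a planar integral lattice $L$ contains an equilateral $n$-gon (not necessarily convex), then $n\geq p$ for every prime factor $p$ of $\nu(L)$.
   Context: A planar lattice is a set $L[\mathbf{a},\mathbf{b}]=\{m\mathbf{a}+n\mathbf{b}\mid m,n\in\mathbb{Z}\}\subset\mathbb{R}^2$ for linearly independent vectors $\mathbf{a},\mathbf{b}\in\mathbb{R}^2$. It is integral if $\mathbf{x}\cdot\mathbf{y}\in\mathbb{Z}$ for all $\mathbf{x},\mathbf{y}\in L$. $D(L)=|\det(\mathbf{a},\mathbf{b})|$ is the area of a fundamental parallelogram (independent of the choice of generators); for integral $L$, $D(L)^2$ is a positive integer, and $\nu(L)$ denotes its square-free part, i.e. the square-free positive integer with $D(L)^2=k^2\nu(L)$ for some integer $k$. An equilateral $n$-gon is a polygon with $n$ vertices whose sides all have equal length; a set $S$ contains a polygon if every vertex of the polygon lies in $S$. -}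

module Defs where

open import Data.Nat as ℕ using (ℕ; suc; _%_)
open import Data.Nat.DivMod using (m%n<n)
open import Data.Nat.Divisibility using (_∣_)
open import Data.Integer as ℤ using (ℤ; _+_; _*_; _-_; ∣_∣)
open import Data.Fin using (Fin; toℕ; fromℕ<)
open import Data.Product using (_×_; _,_; Σ; ∃)
open import Relation.Binary.PropositionalEquality using (_≡_)

-- A planar integral lattice, described up to isometry by its Gram matrix
-- with respect to a basis a, b:  A = a·a, B = a·b, C = b·b  (all integers,
-- since the lattice is integral), positive definite (a, b linearly independent).
record IntegralLattice : Set where
  constructor lattice
  field
    A B C  : ℤ
    A-pos  : ℤ.+0 ℤ.< A
    det-pos : ℤ.+0 ℤ.< A * C - B * B

-- Lattice points m·a + n·b are recorded by their coordinates (m , n).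
Point : Set
Point = ℤ × ℤ

_−ᵖ_ : Point → Point → Point
(m₁ , n₁) −ᵖ (m₂ , n₂) = (m₁ - m₂ , n₁ - n₂)

dot : IntegralLattice → Point → Point → ℤ
dot L (m₁ , n₁) (m₂ , n₂) =
  A * (m₁ * m₂) + B * (m₁ * n₂ + n₁ * m₂) + C * (n₁ * n₂)
  where open IntegralLattice L

dist² : IntegralLattice → Point → Point → ℤ
dist² L x y = dot L (x −ᵖ y) (x −ᵖ y)

-- D(L)^2 = det(a,b)^2 = A C - B^2 (a positive integer)
D² : IntegralLattice → ℕ
D² L = ∣ A * C - B * B ∣
  where open IntegralLattice L

-- square-free positive integers (d = 0 excludes k = 0)
SquareFree : ℕ → Set
SquareFree k = ∀ (d : ℕ) → d ℕ.* d ∣ k → d ≡ 1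

IsSquareFreePart : ℕ → ℕ → Set
IsSquareFreePart D s = SquareFree s × ∃ λ (k : ℕ) → k ℕ.* k ℕ.* s ≡ D

next : ∀ {n} → Fin n → Fin n
next {suc m} i = fromℕ< (m%n<n (suc (toℕ i)) (suc m))

EquilateralPolygonIn : IntegralLattice → (n : ℕ) → Set
EquilateralPolygonIn L n =
  Σ (Fin n → Point) λ v →
    (∀ i j → v i ≡ v j → i ≡ j) ×
    ∃ λ (s : ℤ) → ∀ (i : Fin n) → dist² L (v (next i)) (v i) ≡ s

{-# OPTIONS --safe #-}
module Submission where

-- Write the edges of the polygon as e_i = m_i a + n_i b.  Lagrange's identity
-- |a|²|e|² = (a·e)² + det(a,e)² with det(a,e)² = D(L)² n² = j² p δ n² turns the
-- equal side lengths into X_i² + p δ Y_i² = t for X_i = a·e_i, Y_i = j n_i and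
-- t = |a|² |e_i|² ≠ 0, while ΣX_i = ΣY_i = 0 because the polygon closes up; here
-- ν(L) = p δ with p ∤ δ by square-freeness.  Now descend on |t| over the forms
-- α X² + p δ Y² with p ∤ α δ.  If p ∤ t, then every X_i ≡ ±X_0 (mod p) and
-- p ∤ X_0, so p divides the difference of the numbers of + and − signs; that
-- difference is odd and smaller than n < p in absolute value, which is absurd.
-- If p ∣ t, then p ∣ X_i for all i, and X_i = p X_i' gives δ Y_i² + p α X_i'² = t/p,
-- a smaller instance of the same shape.

open import Defs
open import Data.Empty using (⊥; ⊥-elim)
open import Data.Fin as Fin using (Fin; zero; suc; toℕ; inject₁; fromℕ)
import Data.Fin.Properties as Fin
open import Data.Nat as ℕ
  using (ℕ; zero; suc; NonZero; NonTrivial; nonTrivial⇒n>1; nonTrivial⇒≢1; nonTrivial⇒nonZero)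
import Data.Nat.Properties as ℕ
open import Data.Nat.DivMod using (m≤n⇒m%n≡m; n%n≡0)
open import Data.Nat.Divisibility as ℕ using (∣⇒≤; ∣1⇒≡1)
open import Data.Nat.Induction using (<-wellFounded)
open import Data.Nat.Primality using (Prime; euclidsLemma; prime⇒nonTrivial)
open import Data.Product using (_×_; _,_; ∃; ∃₂; proj₁; proj₂)
open import Data.Sum as Sum using (_⊎_; inj₁; inj₂; [_,_]′)
open import Data.Vec.Functional using (Vector; init)
open import Function using (id; _∘_)
open import Induction.WellFounded using (Acc; acc)
open import Relation.Binary.PropositionalEquality
open import Relation.Nullary using (¬_; Dec; yes; no)

module ZeroSumRepresentations where
  open import Data.Integer as ℤ using (ℤ; +_; 0ℤ; 1ℤ; _+_; _-_; _*_)
  import Data.Integer.Properties as ℤ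
  open import Data.Integer.Divisibility.Signed
    using (_∣_; _∣?_; divides; quotient; ∣⇒∣ᵤ; ∣ᵤ⇒∣; ∣m∣n⇒∣m+n; ∣m∣n⇒∣m-n; ∣m⇒∣m*n; ∣n⇒∣m*n)
  open import Data.Integer.Tactic.RingSolver using (solve-∀)
  open import Algebra.Properties.Semiring.Sum ℤ.+-*-semiring using (sum; sum-cong-≗; *-distribʳ-sum)
  open ≡-Reasoning

  _∣0 : ∀ m → m ∣ 0ℤ
  m ∣0 = divides 0ℤ refl

  ∣m∣m-n⇒∣n : ∀ {d m n} → d ∣ m → d ∣ m - n → d ∣ n
  ∣m∣m-n⇒∣n {d} {m} {n} d∣m d∣m-n = subst (d ∣_) (m-[m-n]≡n m n) (∣m∣n⇒∣m-n d∣m d∣m-n)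
    where
    m-[m-n]≡n : ∀ m n → m - (m - n) ≡ n
    m-[m-n]≡n = solve-∀

  ∣m-n∣n⇒∣m : ∀ {d m n} → d ∣ m - n → d ∣ n → d ∣ m
  ∣m-n∣n⇒∣m {d} {m} {n} d∣m-n d∣n = subst (d ∣_) (m-n+n≡m m n) (∣m∣n⇒∣m+n d∣m-n d∣n)
    where
    m-n+n≡m : ∀ m n → m - n + n ≡ m
    m-n+n≡m = solve-∀

  sum-of-±x₀ : ∀ {m x₀ : ℤ} {N} (x : Vector ℤ N) → (∀ i → m ∣ x i - x₀ ⊎ m ∣ x i + x₀) →
               ∃₂ λ r s → r ℕ.+ s ≡ N × m ∣ sum x - (+ r - + s) * x₀
  sum-of-±x₀ {m} {N = zero} x ± = 0 , 0 , refl , m ∣0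
  sum-of-±x₀ {m} {x₀} {N = suc N} x ± with sum-of-±x₀ (x ∘ suc) (± ∘ suc) | ± zero
  ... | r , s , r+s≡N , m∣Σ | inj₁ m∣x-x₀ =
    suc r , s , cong suc r+s≡N ,
    subst (m ∣_) (plus (x zero) (sum (x ∘ suc)) (+ r) (+ s) x₀) (∣m∣n⇒∣m+n m∣x-x₀ m∣Σ)
    where
    plus : ∀ a Σ R S x₀ → a - x₀ + (Σ - (R - S) * x₀) ≡ a + Σ - (1ℤ + R - S) * x₀
    plus = solve-∀
  ... | r , s , r+s≡N , m∣Σ | inj₂ m∣x+x₀ =
    r , suc s , trans (ℕ.+-suc r s) (cong suc r+s≡N) ,
    subst (m ∣_) (minus (x zero) (sum (x ∘ suc)) (+ r) (+ s) x₀) (∣m∣n⇒∣m+n m∣x+x₀ m∣Σ)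
    where
    minus : ∀ a Σ R S x₀ → a + x₀ + (Σ - (R - S) * x₀) ≡ a + Σ - (R - (1ℤ + S)) * x₀
    minus = solve-∀

  odd≢double : ∀ k → ¬ (∃ λ r → suc (2 ℕ.* k) ≡ r ℕ.+ r)
  odd≢double k (r , odd≡r+r) = ℕ.even≢odd r k (trans (cong (r ℕ.+_) (ℕ.+-identityʳ r)) (sym odd≡r+r))

  record ZeroSumRepresentation (α β t : ℤ) {N} (x y : Vector ℤ N) : Set where
    field
      represents : ∀ i → α * (x i * x i) + β * (y i * y i) ≡ t
      sum-x≡0    : sum x ≡ 0ℤ
      sum-y≡0    : sum y ≡ 0ℤ

  module _ {p : ℕ} (p-prime : Prime p) where

    private
      instance
        p-nonTrivial : NonTrivial p
        p-nonTrivial = prime⇒nonTrivial p-prime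
        p-nonZero : NonZero p
        p-nonZero = nonTrivial⇒nonZero p

    p∤1 : ¬ + p ∣ 1ℤ
    p∤1 p∣1 = nonTrivial⇒≢1 (∣1⇒≡1 (∣⇒∣ᵤ p∣1))

    p∣*⇒p∣⊎p∣ : ∀ {i j} → + p ∣ i * j → + p ∣ i ⊎ + p ∣ j
    p∣*⇒p∣⊎p∣ {i} {j} p∣ij =
      Sum.map ∣ᵤ⇒∣ ∣ᵤ⇒∣ (euclidsLemma ℤ.∣ i ∣ ℤ.∣ j ∣ p-prime p∣∣i∣*∣j∣)
      where
      p∣∣i∣*∣j∣ : p ℕ.∣ ℤ.∣ i ∣ ℕ.* ℤ.∣ j ∣
      p∣∣i∣*∣j∣ = subst (p ℕ.∣_) (ℤ.abs-* i j) (∣⇒∣ᵤ p∣ij)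

    p∣i*i⇒p∣i : ∀ {i} → + p ∣ i * i → + p ∣ i
    p∣i*i⇒p∣i = Sum.reduce ∘ p∣*⇒p∣⊎p∣

    p∣*⇒p∣ʳ : ∀ {i j} → ¬ + p ∣ i → + p ∣ i * j → + p ∣ j
    p∣*⇒p∣ʳ p∤i = [ ⊥-elim ∘ p∤i , id ]′ ∘ p∣*⇒p∣⊎p∣

    p∣*⇒p∣ˡ : ∀ {i j} → ¬ + p ∣ j → + p ∣ i * j → + p ∣ i
    p∣*⇒p∣ˡ p∤j = [ id , ⊥-elim ∘ p∤j ]′ ∘ p∣*⇒p∣⊎p∣

    p∣r-s⇒r≡s : ∀ {r s} → r ℕ.+ s ℕ.< p → + p ∣ + r - + s → r ≡ s
    p∣r-s⇒r≡s {r} {s} r+s<p p∣r-s with ℤ.∣ + r - + s ∣ ℕ.≟ 0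
    ... | yes ∣r-s∣≡0 = ℤ.+-injective (ℤ.i-j≡0⇒i≡j (+ r) (+ s) (ℤ.∣i∣≡0⇒i≡0 ∣r-s∣≡0))
    ... | no ∣r-s∣≢0 =
      ⊥-elim (ℕ.<⇒≱ r+s<p (ℕ.≤-trans p≤∣r-s∣ (ℤ.∣i-j∣≤∣i∣+∣j∣ (+ r) (+ s))))
      where
      p≤∣r-s∣ : p ℕ.≤ ℤ.∣ + r - + s ∣
      p≤∣r-s∣ = ∣⇒≤ {{ℕ.≢-nonZero ∣r-s∣≢0}} (∣⇒∣ᵤ p∣r-s)

    ∣quotient∣<∣t∣ : ∀ {t} → t ≢ 0ℤ → (p∣t : + p ∣ t) → ℤ.∣ quotient p∣t ∣ ℕ.< ℤ.∣ t ∣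
    ∣quotient∣<∣t∣ t≢0 (divides t′ refl) =
      subst (ℤ.∣ t′ ∣ ℕ.<_) (sym (ℤ.abs-* t′ (+ p))) ∣t′∣<∣t′∣*p
      where
      instance
        ∣t′∣-nonZero : NonZero ℤ.∣ t′ ∣
        ∣t′∣-nonZero = ℕ.≢-nonZero (t≢0 ∘ cong (_* + p) ∘ ℤ.∣i∣≡0⇒i≡0 {t′})
      ∣t′∣<∣t′∣*p : ℤ.∣ t′ ∣ ℕ.< ℤ.∣ t′ ∣ ℕ.* p
      ∣t′∣<∣t′∣*p = ℕ.m<m*n ℤ.∣ t′ ∣ p (nonTrivial⇒n>1 p)

    quotient≢0 : ∀ {t} → t ≢ 0ℤ → (p∣t : + p ∣ t) → quotient p∣t ≢ 0ℤ
    quotient≢0 t≢0 (divides t′ refl) t′≡0 = t≢0 (cong (_* + p) t′≡0)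

    module _ {α δ t : ℤ} {N} {x y : Vector ℤ N} (rep : ZeroSumRepresentation α (+ p * δ) t x y) where
      open ZeroSumRepresentation rep

      p∣t-αx² : ∀ i → + p ∣ t - α * (x i * x i)
      p∣t-αx² i = subst (λ t → + p ∣ t - α * (x i * x i)) (represents i)
        (divides (δ * (y i * y i)) (cancel α δ (+ p) (x i) (y i)))
        where
        cancel : ∀ α δ P X Y → α * (X * X) + P * δ * (Y * Y) - α * (X * X) ≡ δ * (Y * Y) * P
        cancel = solve-∀

      p∤t⇒even : Fin N → ¬ + p ∣ α → ¬ + p ∣ t → N ℕ.< p → ∃ λ r → N ≡ r ℕ.+ r
      p∤t⇒even i₀ p∤α p∤t N<p = balanced (sum-of-±x₀ x ±x₀)
        where
        x₀ = x i₀
        ±x₀ : ∀ i → + p ∣ x i - x₀ ⊎ + p ∣ x i + x₀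
        ±x₀ i = p∣*⇒p∣⊎p∣ (p∣*⇒p∣ʳ p∤α p∣α[x-x₀][x+x₀])
          where
          difference-of-squares : ∀ t α X X₀ →
            t - α * (X₀ * X₀) - (t - α * (X * X)) ≡ α * ((X - X₀) * (X + X₀))
          difference-of-squares = solve-∀
          p∣α[x-x₀][x+x₀] : + p ∣ α * ((x i - x₀) * (x i + x₀))
          p∣α[x-x₀][x+x₀] = subst (+ p ∣_) (difference-of-squares t α (x i) x₀)
                                  (∣m∣n⇒∣m-n (p∣t-αx² i₀) (p∣t-αx² i))
        p∤x₀ : ¬ + p ∣ x₀
        p∤x₀ p∣x₀ = p∤t (∣m-n∣n⇒∣m (p∣t-αx² i₀) (∣n⇒∣m*n α (∣m⇒∣m*n x₀ p∣x₀)))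
        balanced : (∃₂ λ r s → r ℕ.+ s ≡ N × + p ∣ sum x - (+ r - + s) * x₀) → ∃ λ r → N ≡ r ℕ.+ r
        balanced (r , s , r+s≡N , p∣Σ-[r-s]x₀) = r , trans (sym r+s≡N) (cong (r ℕ.+_) (sym r≡s))
          where
          p∣Σ : + p ∣ sum x
          p∣Σ = subst (+ p ∣_) (sym sum-x≡0) ((+ p) ∣0)
          r≡s : r ≡ s
          r≡s = p∣r-s⇒r≡s (subst (ℕ._< p) (sym r+s≡N) N<p)
                          (p∣*⇒p∣ˡ p∤x₀ (∣m∣m-n⇒∣n p∣Σ p∣Σ-[r-s]x₀))

      p∣t⇒p∣x : ¬ + p ∣ α → + p ∣ t → ∀ i → + p ∣ x i
      p∣t⇒p∣x p∤α p∣t i = p∣i*i⇒p∣i (p∣*⇒p∣ʳ p∤α (∣m∣m-n⇒∣n p∣t (p∣t-αx² i)))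

      rescale : ¬ + p ∣ α → (p∣t : + p ∣ t) →
                ∃ λ x′ → ZeroSumRepresentation δ (+ p * α) (quotient p∣t) y x′
      rescale p∤α p∣t@(divides t′ t≡t′p) = x′ , record
        { represents = represents′
        ; sum-x≡0    = sum-y≡0
        ; sum-y≡0    = ℤ.*-cancelʳ-≡ (sum x′) 0ℤ (+ p) (begin
            sum x′ * + p              ≡⟨ *-distribʳ-sum (+ p) x′ ⟩
            sum (λ i → x′ i * + p)    ≡⟨ sum-cong-≗ (sym ∘ x≡x′p) ⟩
            sum x                     ≡⟨ sum-x≡0 ⟩
            0ℤ                        ∎)
        }
        where
        p∣x = p∣t⇒p∣x p∤α p∣t
        x′ : Vector ℤ N
        x′ i = quotient (p∣x i)
        x≡x′p : ∀ i → x i ≡ x′ i * + p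
        x≡x′p i = _∣_.equality (p∣x i)
        expand : ∀ α δ P X Y →
          (δ * (Y * Y) + P * α * (X * X)) * P ≡ α * ((X * P) * (X * P)) + P * δ * (Y * Y)
        expand = solve-∀
        represents′ : ∀ i → δ * (y i * y i) + + p * α * (x′ i * x′ i) ≡ t′
        represents′ i = ℤ.*-cancelʳ-≡ _ t′ (+ p) (begin
          (δ * (y i * y i) + + p * α * (x′ i * x′ i)) * + p        ≡⟨ expand α δ (+ p) (x′ i) (y i) ⟩
          α * (x′ i * + p * (x′ i * + p)) + + p * δ * (y i * y i)  ≡⟨ cong (λ X → α * (X * X) + + p * δ * (y i * y i))
                                                                            (x≡x′p i) ⟨
          α * (x i * x i) + + p * δ * (y i * y i)                  ≡⟨ represents i ⟩
          t                                                        ≡⟨ t≡t′p ⟩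
          t′ * + p                                                 ∎)

    no-odd-zero-sum-representation : ∀ {α δ t k} {x y : Vector ℤ (suc (2 ℕ.* k))} →
      ¬ + p ∣ α → ¬ + p ∣ δ → t ≢ 0ℤ → suc (2 ℕ.* k) ℕ.< p →
      ZeroSumRepresentation α (+ p * δ) t x y → ⊥
    no-odd-zero-sum-representation {t = t} {k} = descent {k = k} (<-wellFounded ℤ.∣ t ∣)
      where
      descent : ∀ {α δ t k} {x y : Vector ℤ (suc (2 ℕ.* k))} → Acc ℕ._<_ ℤ.∣ t ∣ →
        ¬ + p ∣ α → ¬ + p ∣ δ → t ≢ 0ℤ → suc (2 ℕ.* k) ℕ.< p →
        ZeroSumRepresentation α (+ p * δ) t x y → ⊥
      descent {t = t} {k} (acc smaller) p∤α p∤δ t≢0 N<p rep = cases (+ p ∣? t)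
        where
        cases : Dec (+ p ∣ t) → ⊥
        cases (no p∤t)  = odd≢double k (p∤t⇒even {N = suc (2 ℕ.* k)} rep zero p∤α p∤t N<p)
        cases (yes p∣t) = descent {k = k} (smaller (∣quotient∣<∣t∣ t≢0 p∣t))
                            p∤δ p∤α (quotient≢0 t≢0 p∣t) N<p (proj₂ (rescale rep p∤α p∣t))

    p∣squareFreePart⇒≡j*j*[p*δ] : ∀ {Δ ν} → 0ℤ ℤ.< Δ → IsSquareFreePart ℤ.∣ Δ ∣ ν → p ℕ.∣ ν →
                                   ∃₂ λ j δ → Δ ≡ j * j * (+ p * δ) × ¬ + p ∣ δ
    p∣squareFreePart⇒≡j*j*[p*δ] {Δ} 0<Δ (ν-squareFree , k , k*k*ν≡∣Δ∣) (ℕ.divides δ refl) =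
      + k , + δ , Δ≡k*k*[p*δ] , p∤δ
      where
      p∤δ : ¬ + p ∣ + δ
      p∤δ p∣δ = nonTrivial⇒≢1 (ν-squareFree p (ℕ.*-monoˡ-∣ p (∣⇒∣ᵤ p∣δ)))
      Δ≡k*k*[p*δ] : Δ ≡ + k * + k * (+ p * + δ)
      Δ≡k*k*[p*δ] = begin
        Δ                           ≡⟨ ℤ.0≤i⇒+∣i∣≡i (ℤ.<⇒≤ 0<Δ) ⟨
        + ℤ.∣ Δ ∣                   ≡⟨ cong +_ k*k*ν≡∣Δ∣ ⟨
        + (k ℕ.* k ℕ.* (δ ℕ.* p))   ≡⟨ ℤ.pos-* (k ℕ.* k) (δ ℕ.* p) ⟩
        + (k ℕ.* k) * + (δ ℕ.* p)   ≡⟨ cong₂ _*_ (ℤ.pos-* k k)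
                                                (trans (ℤ.pos-* δ p) (ℤ.*-comm (+ δ) (+ p))) ⟩
        + k * + k * (+ p * + δ)     ∎

module EquilateralPolygons where
  open import Data.Integer as ℤ using (ℤ; +_; 0ℤ; 1ℤ; _+_; _-_; _*_)
  import Data.Integer.Properties as ℤ
  open import Data.Integer.Tactic.RingSolver using (solve-∀)
  open import Algebra.Properties.Semiring.Sum ℤ.+-*-semiring using (sum; sum-init-last; sum-cong-≗)
  open ≡-Reasoning
  open ZeroSumRepresentations using (ZeroSumRepresentation)

  next-inject₁ : ∀ {m} (i : Fin m) → next (inject₁ i) ≡ suc i
  next-inject₁ {m} i = Fin.toℕ-injective (begin
    toℕ (next (inject₁ i))            ≡⟨ Fin.toℕ-fromℕ< _ ⟩
    suc (toℕ (inject₁ i)) ℕ.% suc m   ≡⟨ cong (λ j → suc j ℕ.% suc m) (Fin.toℕ-inject₁ i) ⟩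
    suc (toℕ i) ℕ.% suc m             ≡⟨ m≤n⇒m%n≡m (Fin.toℕ<n i) ⟩
    suc (toℕ i)                       ∎)

  next-fromℕ : ∀ m → next (fromℕ m) ≡ zero
  next-fromℕ m = Fin.toℕ-injective (begin
    toℕ (next (fromℕ m))            ≡⟨ Fin.toℕ-fromℕ< _ ⟩
    suc (toℕ (fromℕ m)) ℕ.% suc m   ≡⟨ cong (λ j → suc j ℕ.% suc m) (Fin.toℕ-fromℕ m) ⟩
    suc m ℕ.% suc m                 ≡⟨ n%n≡0 (suc m) ⟩
    0                               ∎)

  sum-∘next : ∀ {n} (f : Vector ℤ n) → sum (f ∘ next) ≡ sum f
  sum-∘next {zero}  f = refl
  sum-∘next {suc m} f = begin
    sum (f ∘ next)                              ≡⟨ sum-init-last (f ∘ next) ⟩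
    sum (init (f ∘ next)) + f (next (fromℕ m))  ≡⟨ cong₂ _+_ (sum-cong-≗ (cong f ∘ next-inject₁))
                                                             (cong f (next-fromℕ m)) ⟩
    sum (f ∘ suc) + f zero                      ≡⟨ ℤ.+-comm (sum (f ∘ suc)) (f zero) ⟩
    sum f                                       ∎

  ∑-distrib-− : ∀ {n} (f g : Vector ℤ n) → sum (λ i → f i - g i) ≡ sum f - sum g
  ∑-distrib-− {zero}  f g = refl
  ∑-distrib-− {suc n} f g =
    trans (cong (_+_ (f zero - g zero)) (∑-distrib-− (f ∘ suc) (g ∘ suc)))
          (interchange (f zero) (g zero) (sum (f ∘ suc)) (sum (g ∘ suc)))
    where
    interchange : ∀ a b c d → a - b + (c - d) ≡ a + c - (b + d)
    interchange = solve-∀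

  sum-telescope : ∀ {n} (f : Vector ℤ n) → sum (λ i → f (next i) - f i) ≡ 0ℤ
  sum-telescope f = begin
    sum (λ i → f (next i) - f i)  ≡⟨ ∑-distrib-− (f ∘ next) f ⟩
    sum (f ∘ next) - sum f        ≡⟨ cong (_- sum f) (sum-∘next f) ⟩
    sum f - sum f                 ≡⟨ ℤ.+-inverseʳ (sum f) ⟩
    0ℤ                            ∎

  edge : ∀ {N} → (Fin N → Point) → Fin N → Point
  edge v i = v (next i) −ᵖ v i

  sum-edges≡0 : ∀ {N} (φ : Point → ℤ) → (∀ p q → φ (p −ᵖ q) ≡ φ p - φ q) → (v : Fin N → Point) →
                sum (φ ∘ edge v) ≡ 0ℤ
  sum-edges≡0 φ φ-linear v =
    trans (sum-cong-≗ (λ i → φ-linear (v (next i)) (v i))) (sum-telescope (φ ∘ v))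

  −ᵖ≡0⇒≡ : ∀ {p q} → p −ᵖ q ≡ (0ℤ , 0ℤ) → p ≡ q
  −ᵖ≡0⇒≡ {m₁ , n₁} {m₂ , n₂} eq =
    cong₂ _,_ (ℤ.i-j≡0⇒i≡j m₁ m₂ (cong proj₁ eq)) (ℤ.i-j≡0⇒i≡j n₁ n₂ (cong proj₂ eq))

  *-distribˡ-− : ∀ i j k → i * (j - k) ≡ i * j - i * k
  *-distribˡ-− = solve-∀

  i*i≡+∣i∣*∣i∣ : ∀ i → i * i ≡ + (ℤ.∣ i ∣ ℕ.* ℤ.∣ i ∣)
  i*i≡+∣i∣*∣i∣ (+ n)      = sym (ℤ.pos-* n n)
  i*i≡+∣i∣*∣i∣ ℤ.-[1+ n ] = refl

  x*x+d*[y*y]≡0⇒x≡0×y≡0 : ∀ {d} x y → 0ℤ ℤ.< d → x * x + d * (y * y) ≡ 0ℤ → x ≡ 0ℤ × y ≡ 0ℤ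
  x*x+d*[y*y]≡0⇒x≡0×y≡0 {+ suc d} x y (ℤ.+<+ _) eq =
    square≡0⇒≡0 x (ℕ.m+n≡0⇒m≡0 u u+[1+d]w≡0) ,
    square≡0⇒≡0 y (ℕ.m+n≡0⇒m≡0 w (ℕ.m+n≡0⇒n≡0 u u+[1+d]w≡0))
    where
    u = ℤ.∣ x ∣ ℕ.* ℤ.∣ x ∣
    w = ℤ.∣ y ∣ ℕ.* ℤ.∣ y ∣
    square≡0⇒≡0 : ∀ i → ℤ.∣ i ∣ ℕ.* ℤ.∣ i ∣ ≡ 0 → i ≡ 0ℤ
    square≡0⇒≡0 i = ℤ.∣i∣≡0⇒i≡0 ∘ Sum.reduce ∘ ℕ.m*n≡0⇒m≡0∨n≡0 ℤ.∣ i ∣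
    u+[1+d]w≡0 : u ℕ.+ suc d ℕ.* w ≡ 0
    u+[1+d]w≡0 = ℤ.+-injective (begin
      + (u ℕ.+ suc d ℕ.* w)      ≡⟨ ℤ.pos-+ u (suc d ℕ.* w) ⟩
      + u + + (suc d ℕ.* w)      ≡⟨ cong (_+_ (+ u)) (ℤ.pos-* (suc d) w) ⟩
      + u + + suc d * + w        ≡⟨ cong₂ (λ X Y → X + + suc d * Y) (i*i≡+∣i∣*∣i∣ x) (i*i≡+∣i∣*∣i∣ y) ⟨
      x * x + + suc d * (y * y)  ≡⟨ eq ⟩
      0ℤ                         ∎)

  module _ (L : IntegralLattice) where
    open IntegralLattice L

    Δ : ℤ
    Δ = A * C - B * B

    a·_ : Point → ℤ
    a· (m , n) = A * m + B * n

    a·-−ᵖ : ∀ p q → a· (p −ᵖ q) ≡ a· p - a· q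
    a·-−ᵖ (m₁ , n₁) (m₂ , n₂) = distributes A B m₁ n₁ m₂ n₂
      where
      distributes : ∀ A B m₁ n₁ m₂ n₂ →
        A * (m₁ - m₂) + B * (n₁ - n₂) ≡ A * m₁ + B * n₁ - (A * m₂ + B * n₂)
      distributes = solve-∀

    -- |a|²|e|² = (a·e)² + det(a,e)², and det(a, m a + n b) = n det(a,b).
    lagrange-identity : ∀ e → A * dot L e e ≡ a· e * a· e + Δ * (proj₂ e * proj₂ e)
    lagrange-identity (m , n) = identity A B C m n
      where
      identity : ∀ A B C m n → A * (A * (m * m) + B * (m * n + n * m) + C * (n * n))
                 ≡ (A * m + B * n) * (A * m + B * n) + (A * C - B * B) * (n * n)
      identity = solve-∀

    A≢0 : A ≢ 0ℤ
    A≢0 A≡0 = ℤ.<-irrefl (sym A≡0) A-pos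

    dot-self≡0⇒≡0 : ∀ e → dot L e e ≡ 0ℤ → e ≡ (0ℤ , 0ℤ)
    dot-self≡0⇒≡0 (m , n) e·e≡0 = cong₂ _,_ m≡0 n≡0
      where
      squares≡0 : a· (m , n) * a· (m , n) + Δ * (n * n) ≡ 0ℤ
      squares≡0 = begin
        a· (m , n) * a· (m , n) + Δ * (n * n)  ≡⟨ lagrange-identity (m , n) ⟨
        A * dot L (m , n) (m , n)              ≡⟨ cong (A *_) e·e≡0 ⟩
        A * 0ℤ                                 ≡⟨ ℤ.*-zeroʳ A ⟩
        0ℤ                                     ∎
      a·e≡0×n≡0 = x*x+d*[y*y]≡0⇒x≡0×y≡0 (a· (m , n)) n det-pos squares≡0
      n≡0 : n ≡ 0ℤ
      n≡0 = proj₂ a·e≡0×n≡0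
      Am≡0 : A * m ≡ 0ℤ
      Am≡0 = begin
        A * m            ≡⟨ ℤ.+-identityʳ (A * m) ⟨
        A * m + 0ℤ       ≡⟨ cong (_+_ (A * m)) (ℤ.*-zeroʳ B) ⟨
        A * m + B * 0ℤ   ≡⟨ cong (λ n → A * m + B * n) n≡0 ⟨
        a· (m , n)       ≡⟨ proj₁ a·e≡0×n≡0 ⟩
        0ℤ               ∎
      m≡0 : m ≡ 0ℤ
      m≡0 = [ ⊥-elim ∘ A≢0 , id ]′ (ℤ.i*j≡0⇒i≡0∨j≡0 A Am≡0)

    polygon⇒zeroSumRepresentation : ∀ {N} → 1 ℕ.< N → EquilateralPolygonIn L N →
      ∀ {j β} → Δ ≡ j * j * β →
      ∃ λ t → t ≢ 0ℤ × ∃₂ λ (x y : Vector ℤ N) → ZeroSumRepresentation 1ℤ β t x y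
    polygon⇒zeroSumRepresentation (ℕ.s≤s (ℕ.s≤s ℕ.z≤n)) (v , v-injective , s , sides) {j} {β} Δ≡j*j*β =
      A * s , As≢0 , x , y , representation
      where
      x y : Vector ℤ _
      x i = a· edge v i
      y i = j * proj₂ (edge v i)
      represents : ∀ i → 1ℤ * (x i * x i) + β * (y i * y i) ≡ A * s
      represents i = begin
        1ℤ * (X * X) + β * ((j * n) * (j * n))   ≡⟨ regroup X β j n ⟩
        X * X + j * j * β * (n * n)              ≡⟨ cong (λ d → X * X + d * (n * n)) Δ≡j*j*β ⟨
        X * X + Δ * (n * n)                      ≡⟨ lagrange-identity (edge v i) ⟨
        A * dot L (edge v i) (edge v i)          ≡⟨ cong (A *_) (sides i) ⟩
        A * s                                    ∎
        where
        X = x i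
        n = proj₂ (edge v i)
        regroup : ∀ X β j n → 1ℤ * (X * X) + β * ((j * n) * (j * n)) ≡ X * X + j * j * β * (n * n)
        regroup = solve-∀
      As≢0 : A * s ≢ 0ℤ
      As≢0 As≡0 = Fin.0≢1+n (trans (sym next-zero≡zero) (next-inject₁ zero))
        where
        s≡0 : s ≡ 0ℤ
        s≡0 = [ ⊥-elim ∘ A≢0 , id ]′ (ℤ.i*j≡0⇒i≡0∨j≡0 A As≡0)
        next-zero≡zero : next zero ≡ zero
        next-zero≡zero =
          v-injective _ _ (−ᵖ≡0⇒≡ (dot-self≡0⇒≡0 (edge v zero) (trans (sides zero) s≡0)))
      representation : ZeroSumRepresentation 1ℤ β (A * s) x y
      representation = record
        { represents = represents
        ; sum-x≡0    = sum-edges≡0 a·_ a·-−ᵖ v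
        ; sum-y≡0    = sum-edges≡0 (λ e → j * proj₂ e) (λ p q → *-distribˡ-− j (proj₂ p) (proj₂ q)) v
        }

open ZeroSumRepresentations
open EquilateralPolygons

open import Data.Nat using (ℕ; _≤_; _+_; _*_)
open import Data.Nat.Divisibility using (_∣_)
open import Data.Nat.Primality using (Prime)
open import Data.Product using (∃)
open import Relation.Binary.PropositionalEquality using (_≡_)

theorem3p1 : (n : ℕ) → 3 ≤ n → (∃ λ (k : ℕ) → n ≡ 2 * k + 1) →
    (L : IntegralLattice) → EquilateralPolygonIn L n →
    (ν : ℕ) → IsSquareFreePart (D² L) ν →
    (p : ℕ) → Prime p → p ∣ ν → p ≤ n
theorem3p1 n 3≤n (k , n≡2k+1) L polygon ν ν-squareFreePart p p-prime p∣ν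
  with refl ← trans n≡2k+1 (ℕ.+-comm (2 * k) 1)
  with j , δ , Δ≡j*j*[p*δ] , p∤δ ←
         p∣squareFreePart⇒≡j*j*[p*δ] p-prime (IntegralLattice.det-pos L) ν-squareFreePart p∣ν
  with t , t≢0 , x , y , representation ←
         polygon⇒zeroSumRepresentation L (ℕ.<⇒≤ 3≤n) polygon {j = j} Δ≡j*j*[p*δ]
  = ℕ.≮⇒≥ λ n<p →
      no-odd-zero-sum-representation p-prime {k = k} (p∤1 p-prime) p∤δ t≢0 n<p representation
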